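{- Let $h_1\ge\dots\ge h_n>0$ be integers and $N=h_1+\dots+h_n$. If a $\mathrm{LC}(h_1\dots h_n)$ exists, then for every subset $D\subseteq\{1,\dots,n\}$, $$N^3-\sum_{i=1}^n h_i^3\;\ge\; N^2\sum_{i\in D}h_i+3\Big(\sum_{i\in D}h_i^2\Big)\Big(N-\sum_{i\in D}h_i\Big)-\sum_{i\in D}h_i^3.$$
   Context: A latin cube of order $N$ is an $N\times N\times N$ array on $N$ symbols such that any two cells whose coordinates differ in exactly one position contain different symbols; a subcube is an $m\times m\times m$ subarray (indices in each coordinate from chosen $m$-sets) that is itself a latin cube of order $m$; subcubes are disjoint if they share no index in any coordinate and no symbol. A $\mathrm{LC}(h_1\dots h_n)$ is a latin cube of order $N=\sum h_i$ with pairwise disjoint subcubes of orders $h_1,\dots,h_n$. -}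

module Defs where

open import Data.Nat using (ℕ; zero; suc; _≤_; _<_)
open import Data.Integer as ℤ using (ℤ; +_)
open import Data.Fin using (Fin; zero; suc)
open import Data.Fin.Subset using (Subset; _∈_)
open import Data.Vec using (lookup)
open import Data.Bool using (Bool; true; false; if_then_else_)
open import Data.Product using (Σ; _×_; _,_)
open import Relation.Binary.PropositionalEquality using (_≡_; _≢_)
open import Function.Definitions using (Injective)

Cube : ℕ → Set
Cube N = Fin N → Fin N → Fin N → Fin N

IsLatinCube : (N : ℕ) → Cube N → Set
IsLatinCube N L =
    (∀ b c → Injective _≡_ _≡_ (λ a → L a b c))
  × (∀ a c → Injective _≡_ _≡_ (λ b → L a b c))
  × (∀ a b → Injective _≡_ _≡_ (λ c → L a b c))

-- A subcube of order m of L: m-subsets of indices in each of the three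
-- coordinates (given by injections Fin m → Fin N) and an m-subset of symbols
-- such that the subarray is a latin cube of order m on those symbols.
record Subcube (N : ℕ) (L : Cube N) (m : ℕ) : Set where
  field
    rows cols files syms : Fin m → Fin N
    rows-inj  : Injective _≡_ _≡_ rows
    cols-inj  : Injective _≡_ _≡_ cols
    files-inj : Injective _≡_ _≡_ files
    syms-inj  : Injective _≡_ _≡_ syms
    sub       : Cube m
    sub-latin : IsLatinCube m sub
    sub-eq    : ∀ a b c → L (rows a) (cols b) (files c) ≡ syms (sub a b c)

Disjoint : ∀ {N L m k} → Subcube N L m → Subcube N L k → Set
Disjoint S T =
    (∀ a b → Subcube.rows S a ≢ Subcube.rows T b)
  × (∀ a b → Subcube.cols S a ≢ Subcube.cols T b)
  × (∀ a b → Subcube.files S a ≢ Subcube.files T b)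
  × (∀ a b → Subcube.syms S a ≢ Subcube.syms T b)

Σℕ : ∀ {n} → (Fin n → ℕ) → ℕ
Σℕ {zero}  f = 0
Σℕ {suc n} f = f zero Data.Nat.+ Σℕ (λ i → f (suc i))

ΣIn : ∀ {n} → Subset n → (Fin n → ℕ) → ℕ
ΣIn {n} D f = Σℕ (λ i → if lookup D i then f i else 0)

LC : ∀ {n} → (Fin n → ℕ) → Set
LC {n} h = Σ (Cube (Σℕ h)) λ L →
           Σ ((i : Fin n) → Subcube (Σℕ h) L (h i)) λ S →
             IsLatinCube (Σℕ h) L
           × (∀ i j → i ≢ j → Disjoint (S i) (S j))

module Submission where

-- Let s = Σ_{i∈D} h_i. Besides the h_i³ cells of each subcube i ∉ D, the cube contains
-- N² cells carrying each of the s symbols of the subcubes in D, and, for each of the three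
-- directions, each subcube i ∈ D and each pair of its indices in the other two coordinates,
-- one cell on that line for each of the N − s symbols outside D. These cells are pairwise
-- distinct: distinct subcubes share no symbol and no coordinate, and two lines of different
-- directions through a subcube of D can only meet inside it, where the symbol lies in D.
-- Counting by an injection into the N³ cells gives
--   Σ_{i∉D} h_i³ + s N² + 3 (Σ_{i∈D} h_i²)(N − s) ≤ N³,
-- which rearranges to the claim.

module Injections where
  open import Data.Product using (_,_; uncurry)
  open import Data.Sum using (inj₁; inj₂; [_,_]′)
  open import Function.Definitions using (Injective)
  open import Relation.Binary.Definitions using (DecidableEquality)
  open import Relation.Binary.PropositionalEquality using (_≡_; _≢_; refl; sym; cong)
  open import Relation.Nullary using (yes; no; contradiction)

  private variable
    A B C : Set

  [,]-injective : {f : A → C} {g : B → C} →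
                  Injective _≡_ _≡_ f → Injective _≡_ _≡_ g → (∀ a b → f a ≢ g b) →
                  Injective _≡_ _≡_ [ f , g ]′
  [,]-injective f-inj _     _   {inj₁ _} {inj₁ _} e = cong inj₁ (f-inj e)
  [,]-injective _     _     f≢g {inj₁ a} {inj₂ b} e = contradiction e (f≢g a b)
  [,]-injective _     _     f≢g {inj₂ b} {inj₁ a} e = contradiction (sym e) (f≢g a b)
  [,]-injective _     g-inj _   {inj₂ _} {inj₂ _} e = cong inj₂ (g-inj e)

  uncurry-injective : {K : Set} {P : K → Set} {f : (k : K) → P k → B} →
                      DecidableEquality K → (∀ k → Injective _≡_ _≡_ (f k)) →
                      (∀ k l → k ≢ l → ∀ a b → f k a ≢ f l b) →
                      Injective _≡_ _≡_ (uncurry f)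
  uncurry-injective _≟_ f-inj disjoint {k , a} {l , b} e with k ≟ l
  ... | yes refl = cong (k ,_) (f-inj k e)
  ... | no k≢l   = contradiction e (disjoint k l k≢l a b)

module FinCounting where
  open import Data.Nat using (ℕ; zero; suc; _+_; _*_; _^_; _≤_)
  open import Data.Nat.Properties using (*-identityʳ; 1+n≰n)
  open import Data.Fin using (Fin; zero; suc; punchOut)
  open import Data.Fin.Properties using (+↔⊎; *↔×; injective⇒≤; any?; _≟_; punchOut-injective)
  open import Data.Product using (Σ; ∃; _×_; _,_)
  open import Data.Product.Function.NonDependent.Propositional using (_×-↔_; _×-↣_)
  open import Data.Sum using (_⊎_; inj₁; inj₂)
  open import Data.Sum.Function.Propositional using (_⊎-↣_)
  open import Function using (_∘_)
  open import Function.Bundles using (_↣_; _↔_; mk↣; Injection)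
  open import Function.Construct.Composition using (_↣-∘_; _↔-∘_)
  open import Function.Construct.Identity using (↔-id)
  open import Function.Definitions using (Injective)
  open import Function.Properties.Inverse using (↔⇒↣)
  open import Relation.Binary.PropositionalEquality using (_≡_; _≢_; refl; sym)
  open import Relation.Nullary using (yes; no; contradiction)
  open import Defs using (Σℕ)

  private variable
    m n a b : ℕ
    A B : Set

  +-↣ : Fin a ↣ A → Fin b ↣ B → Fin (a + b) ↣ (A ⊎ B)
  +-↣ f g = (f ⊎-↣ g) ↣-∘ ↔⇒↣ +↔⊎

  *-↣ : Fin a ↣ A → Fin b ↣ B → Fin (a * b) ↣ (A × B)
  *-↣ f g = (f ×-↣ g) ↣-∘ ↔⇒↣ *↔×

  Σ-suc-↣ : {X : Fin (suc n) → Set} → (X zero ⊎ Σ (Fin n) (X ∘ suc)) ↣ Σ (Fin (suc n)) X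
  Σ-suc-↣ {X = X} = mk↣ injective
    where
    to : X zero ⊎ Σ (Fin _) (X ∘ suc) → Σ (Fin _) X
    to (inj₁ x)       = zero , x
    to (inj₂ (i , x)) = suc i , x
    injective : Injective _≡_ _≡_ to
    injective {inj₁ _}       {inj₁ _}       refl = refl
    injective {inj₂ (_ , _)} {inj₂ (_ , _)} refl = refl

  Σℕ-↣ : {k : Fin n → ℕ} {X : Fin n → Set} → (∀ i → Fin (k i) ↣ X i) → Fin (Σℕ k) ↣ Σ (Fin n) X
  Σℕ-↣ {zero}  _ = mk↣ {to = λ ()} λ {}
  Σℕ-↣ {suc n} f = Σ-suc-↣ ↣-∘ +-↣ (f zero) (Σℕ-↣ (f ∘ suc))

  Fin-^2↔ : Fin (m ^ 2) ↔ (Fin m × Fin m)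
  Fin-^2↔ {m} rewrite *-identityʳ m = *↔×

  Fin-^3↔ : Fin (m ^ 3) ↔ (Fin m × Fin m × Fin m)
  Fin-^3↔ = (↔-id _ ×-↔ Fin-^2↔) ↔-∘ *↔×

  ↣⇒≤ : Fin m ↣ Fin n → m ≤ n
  ↣⇒≤ f = injective⇒≤ (Injection.injective f)

  injective⇒surjective : {f : Fin m → Fin m} → Injective _≡_ _≡_ f → ∀ y → ∃ λ x → f x ≡ y
  injective⇒surjective {zero}  _ ()
  injective⇒surjective {suc m} {f} f-inj y with any? (λ x → f x ≟ y)
  ... | yes hit = hit
  ... | no miss = contradiction (injective⇒≤ punchOut-f-injective) 1+n≰n
    where
    y≢f : ∀ x → y ≢ f x
    y≢f x y≡fx = miss (x , sym y≡fx)
    punchOut-f-injective : Injective _≡_ _≡_ (λ x → punchOut (y≢f x))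
    punchOut-f-injective e = f-inj (punchOut-injective (y≢f _) (y≢f _) e)

module Sums where
  open import Data.Bool using (Bool; true; false; not; if_then_else_)
  open import Data.Nat using (ℕ; zero; suc; _+_)
  open import Data.Nat.Properties using (+-identityʳ; +-commutativeSemigroup)
  open import Algebra.Properties.CommutativeSemigroup +-commutativeSemigroup using (interchange)
  open import Data.Fin using (Fin; zero; suc)
  open import Relation.Binary.PropositionalEquality using (_≡_; refl; sym; trans; cong; cong₂)
  open import Function using (_∘_)
  open import Defs using (Σℕ)

  Σℕ-cong : ∀ {n} {f g : Fin n → ℕ} → (∀ i → f i ≡ g i) → Σℕ f ≡ Σℕ g
  Σℕ-cong {zero}  _   = refl
  Σℕ-cong {suc n} f≡g = cong₂ _+_ (f≡g zero) (Σℕ-cong (f≡g ∘ suc))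

  Σℕ-+ : ∀ {n} (f g : Fin n → ℕ) → Σℕ (λ i → f i + g i) ≡ Σℕ f + Σℕ g
  Σℕ-+ {zero}  _ _ = refl
  Σℕ-+ {suc n} f g = trans (cong (f zero + g zero +_) (Σℕ-+ (f ∘ suc) (g ∘ suc)))
                           (interchange (f zero) (g zero) (Σℕ (f ∘ suc)) (Σℕ (g ∘ suc)))

  Σℕ-split : ∀ {n} (b : Fin n → Bool) (f : Fin n → ℕ) →
             Σℕ f ≡ Σℕ (λ i → if b i then f i else 0) + Σℕ (λ i → if not (b i) then f i else 0)
  Σℕ-split b f = trans (Σℕ-cong λ i → split (b i) (f i))
                       (Σℕ-+ (λ i → if b i then f i else 0) (λ i → if not (b i) then f i else 0))
    where
    split : ∀ b m → m ≡ (if b then m else 0) + (if not b then m else 0)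
    split true  m = sym (+-identityʳ m)
    split false m = refl

module SubcubeCounting where
  open import Data.Nat using (ℕ; _+_; _*_; _^_; _≤_)
  open import Data.Fin using (Fin)
  open import Data.Fin.Patterns using (0F; 1F; 2F)
  open import Data.Fin.Properties using (_≟_)
  open import Data.Product using (Σ; _×_; _,_; proj₁; proj₂; uncurry)
  open import Data.Sum using (_⊎_; inj₁; inj₂; [_,_]′)
  open import Data.Sum.Properties using (≡-dec)
  open import Function using (_∘_)
  open import Function.Bundles using (_↣_; mk↣)
  open import Function.Construct.Composition using (_↣-∘_)
  open import Function.Construct.Identity using (↣-id)
  open import Function.Construct.Symmetry using (↔-sym)
  open import Function.Definitions using (Injective)
  open import Function.Properties.Inverse using (↔⇒↣)
  open import Relation.Binary.Definitions using (DecidableEquality)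
  open import Relation.Binary.PropositionalEquality using (_≡_; _≢_; refl; sym; trans; cong)
  open import Relation.Nullary using (contradiction)
  open import Defs
  open Injections
  open FinCounting

  -- The subcubes indexed by inj₁ play the role of those in D, the ones indexed by inj₂ the rest.
  module _ {N : ℕ} {L : Cube N} (latin : IsLatinCube N L)
           {p q : ℕ} {s : Fin p → ℕ} {t : Fin q → ℕ}
           (U : (k : Fin p ⊎ Fin q) → Subcube N L ([ s , t ]′ k))
           (U-disjoint : ∀ k l → k ≢ l → Disjoint (U k) (U l)) where

    Block : Set
    Block = Σ (Fin p ⊎ Fin q) (Fin ∘ [ s , t ]′)

    row col file symbol : Block → Fin N
    row  = uncurry λ k → Subcube.rows (U k)
    col  = uncurry λ k → Subcube.cols (U k)
    file = uncurry λ k → Subcube.files (U k)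
    symbol = uncurry λ k → Subcube.syms (U k)

    _≟ᵏ_ : DecidableEquality (Fin p ⊎ Fin q)
    _≟ᵏ_ = ≡-dec _≟_ _≟_

    row-injective : Injective _≡_ _≡_ row
    row-injective = uncurry-injective _≟ᵏ_ (λ k → Subcube.rows-inj (U k))
                                          (λ k l k≢l → proj₁ (U-disjoint k l k≢l))

    col-injective : Injective _≡_ _≡_ col
    col-injective = uncurry-injective _≟ᵏ_ (λ k → Subcube.cols-inj (U k))
                                          (λ k l k≢l → proj₁ (proj₂ (U-disjoint k l k≢l)))

    file-injective : Injective _≡_ _≡_ file
    file-injective = uncurry-injective _≟ᵏ_ (λ k → Subcube.files-inj (U k))
                                           (λ k l k≢l → proj₁ (proj₂ (proj₂ (U-disjoint k l k≢l))))

    symbol-injective : Injective _≡_ _≡_ symbol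
    symbol-injective = uncurry-injective _≟ᵏ_ (λ k → Subcube.syms-inj (U k))
                                          (λ k l k≢l → proj₂ (proj₂ (proj₂ (U-disjoint k l k≢l))))

    Cell : Set
    Cell = Fin N × Fin N × Fin N

    entry : Cell → Fin N
    entry (x , y , z) = L x y z

    x-of y-of z-of : Cell → Fin N
    x-of = proj₁
    y-of = proj₁ ∘ proj₂
    z-of = proj₂ ∘ proj₂

    same-cell-same-symbol : ∀ {c c' β β'} → entry c ≡ symbol β → entry c' ≡ symbol β' → c ≡ c' → β ≡ β'
    same-cell-same-symbol σ σ' refl = symbol-injective (trans (sym σ) σ')

    cube-cell : (k : Fin p ⊎ Fin q) (a b c : Fin ([ s , t ]′ k)) → Cell
    cube-cell k a b c = row (k , a) , col (k , b) , file (k , c)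

    cube-cell-entry : ∀ k a b c → entry (cube-cell k a b c) ≡ symbol (k , Subcube.sub (U k) a b c)
    cube-cell-entry k = Subcube.sub-eq (U k)

    -- The cell of the line (·, y, z) with entry σ: every line of a latin cube contains every symbol.
    x-line : (y z σ : Fin N) → Cell
    x-line y z σ = proj₁ (injective⇒surjective (proj₁ latin y z) σ) , y , z

    y-line : (x z σ : Fin N) → Cell
    y-line x z σ = x , proj₁ (injective⇒surjective (proj₁ (proj₂ latin) x z) σ) , z

    z-line : (x y σ : Fin N) → Cell
    z-line x y σ = x , y , proj₁ (injective⇒surjective (proj₂ (proj₂ latin) x y) σ)

    x-line-entry : ∀ y z σ → entry (x-line y z σ) ≡ σ
    x-line-entry y z = proj₂ ∘ injective⇒surjective (proj₁ latin y z)

    y-line-entry : ∀ x z σ → entry (y-line x z σ) ≡ σ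
    y-line-entry x z = proj₂ ∘ injective⇒surjective (proj₁ (proj₂ latin) x z)

    z-line-entry : ∀ x y σ → entry (z-line x y σ) ≡ σ
    z-line-entry x y = proj₂ ∘ injective⇒surjective (proj₂ (proj₂ latin) x y)

    inner : Σ (Fin p) (Fin ∘ s) → Block
    inner (i , a) = inj₁ i , a

    outer : Σ (Fin q) (Fin ∘ t) → Block
    outer (j , a) = inj₂ j , a

    Outer : Set
    Outer = Σ (Fin q) λ j → Fin (t j) × Fin (t j) × Fin (t j)

    Layer : Set
    Layer = (Fin N × Fin N) × Σ (Fin p) (Fin ∘ s)

    LineSpec : Set
    LineSpec = Σ (Fin p) (λ i → Fin (s i) × Fin (s i)) × Σ (Fin q) (Fin ∘ t)

    Line : Set
    Line = Fin 3 × LineSpec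

    outer-cell : Outer → Cell
    outer-cell (j , a , b , c) = cube-cell (inj₂ j) a b c

    layer-cell : Layer → Cell
    layer-cell ((y , z) , α) = x-line y z (symbol (inner α))

    line-cell : Line → Cell
    line-cell (0F , (i , b , c) , β) = x-line (col (inj₁ i , b)) (file (inj₁ i , c)) (symbol (outer β))
    line-cell (1F , (i , b , c) , β) = y-line (row (inj₁ i , b)) (file (inj₁ i , c)) (symbol (outer β))
    line-cell (2F , (i , b , c) , β) = z-line (row (inj₁ i , b)) (col (inj₁ i , c)) (symbol (outer β))

    line-cell-entry : ∀ v → entry (line-cell v) ≡ symbol (outer (proj₂ (proj₂ v)))
    line-cell-entry (0F , _) = x-line-entry _ _ _
    line-cell-entry (1F , _) = y-line-entry _ _ _
    line-cell-entry (2F , _) = z-line-entry _ _ _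

    outer-cell-injective : Injective _≡_ _≡_ outer-cell
    outer-cell-injective e
      with row-injective (cong x-of e) | col-injective (cong y-of e) | file-injective (cong z-of e)
    ... | refl | refl | refl = refl

    layer-cell-injective : Injective _≡_ _≡_ layer-cell
    layer-cell-injective {(y , z) , α} {(y' , z') , α'} e
      with cong y-of e | cong z-of e | same-cell-same-symbol (x-line-entry y z _) (x-line-entry y' z' _) e
    ... | refl | refl | refl = refl

    line-avoids-inner-cubes : ∀ v {i a b c} → line-cell v ≢ cube-cell (inj₁ i) a b c
    line-avoids-inner-cubes v {i} {a} {b} {c} e
      with same-cell-same-symbol (line-cell-entry v) (cube-cell-entry (inj₁ i) a b c) e
    ... | ()

    x-lines≢y-lines : ∀ u v → line-cell (0F , u) ≢ line-cell (1F , v)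
    x-lines≢y-lines ((i , b , c) , _) ((_ , b' , _) , β) e with file-injective (cong z-of e)
    ... | refl = line-avoids-inner-cubes (1F , (i , b' , c) , β)
                   (cong (row (inj₁ i , b') ,_) (cong (_, file (inj₁ i , c)) (sym (cong y-of e))))

    x-lines≢z-lines : ∀ u v → line-cell (0F , u) ≢ line-cell (2F , v)
    x-lines≢z-lines ((i , b , c) , _) ((_ , b' , _) , β) e with col-injective (cong y-of e)
    ... | refl = line-avoids-inner-cubes (2F , (i , b' , b) , β)
                   (cong (row (inj₁ i , b') ,_) (cong (col (inj₁ i , b) ,_) (sym (cong z-of e))))

    y-lines≢z-lines : ∀ u v → line-cell (1F , u) ≢ line-cell (2F , v)
    y-lines≢z-lines ((i , b , c) , _) ((_ , _ , c') , β) e with row-injective (cong x-of e)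
    ... | refl = line-avoids-inner-cubes (2F , (i , b , c') , β)
                   (cong (row (inj₁ i , b) ,_) (cong (col (inj₁ i , c') ,_) (sym (cong z-of e))))

    line-cell-injective : Injective _≡_ _≡_ line-cell
    line-cell-injective {0F , u} {0F , v} e
      with col-injective (cong y-of e) | file-injective (cong z-of e)
         | same-cell-same-symbol (line-cell-entry (0F , u)) (line-cell-entry (0F , v)) e
    ... | refl | refl | refl = refl
    line-cell-injective {1F , u} {1F , v} e
      with row-injective (cong x-of e) | file-injective (cong z-of e)
         | same-cell-same-symbol (line-cell-entry (1F , u)) (line-cell-entry (1F , v)) e
    ... | refl | refl | refl = refl
    line-cell-injective {2F , u} {2F , v} e
      with row-injective (cong x-of e) | col-injective (cong y-of e)
         | same-cell-same-symbol (line-cell-entry (2F , u)) (line-cell-entry (2F , v)) e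
    ... | refl | refl | refl = refl
    line-cell-injective {0F , u} {1F , v} e = contradiction e (x-lines≢y-lines u v)
    line-cell-injective {0F , u} {2F , v} e = contradiction e (x-lines≢z-lines u v)
    line-cell-injective {1F , u} {2F , v} e = contradiction e (y-lines≢z-lines u v)
    line-cell-injective {1F , u} {0F , v} e = contradiction (sym e) (x-lines≢y-lines v u)
    line-cell-injective {2F , u} {0F , v} e = contradiction (sym e) (x-lines≢z-lines v u)
    line-cell-injective {2F , u} {1F , v} e = contradiction (sym e) (y-lines≢z-lines v u)

    outer≢layer : ∀ u v → outer-cell u ≢ layer-cell v
    outer≢layer (j , a , b , c) ((y , z) , α) e
      with same-cell-same-symbol (cube-cell-entry (inj₂ j) a b c) (x-line-entry y z _) e
    ... | ()

    outer≢line : ∀ u v → outer-cell u ≢ line-cell v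
    outer≢line _ (0F , _) e with col-injective (cong y-of e)
    ... | ()
    outer≢line _ (1F , _) e with row-injective (cong x-of e)
    ... | ()
    outer≢line _ (2F , _) e with row-injective (cong x-of e)
    ... | ()

    layer≢line : ∀ u v → layer-cell u ≢ line-cell v
    layer≢line ((y , z) , α) v e with same-cell-same-symbol (x-line-entry y z _) (line-cell-entry v) e
    ... | ()

    cell : Outer ⊎ Layer ⊎ Line → Cell
    cell = [ outer-cell , [ layer-cell , line-cell ]′ ]′

    cell-injective : Injective _≡_ _≡_ cell
    cell-injective = [,]-injective outer-cell-injective
                       ([,]-injective layer-cell-injective line-cell-injective layer≢line)
                       λ { u (inj₁ v) → outer≢layer u v ; u (inj₂ v) → outer≢line u v }

    subcube-count : Σℕ (λ j → t j ^ 3) + (N ^ 2 * Σℕ s + 3 * (Σℕ (λ i → s i ^ 2) * Σℕ t)) ≤ N ^ 3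
    subcube-count = ↣⇒≤ (↔⇒↣ (↔-sym Fin-^3↔) ↣-∘ (mk↣ cell-injective ↣-∘ enumeration))
      where
      enumeration : Fin (Σℕ (λ j → t j ^ 3) + (N ^ 2 * Σℕ s + 3 * (Σℕ (λ i → s i ^ 2) * Σℕ t)))
                    ↣ (Outer ⊎ Layer ⊎ Line)
      enumeration =
        +-↣ (Σℕ-↣ λ _ → ↔⇒↣ Fin-^3↔)
            (+-↣ (*-↣ (↔⇒↣ Fin-^2↔) (Σℕ-↣ λ _ → ↣-id _))
                 (*-↣ (↣-id _) (*-↣ (Σℕ-↣ λ _ → ↔⇒↣ Fin-^2↔) (Σℕ-↣ λ _ → ↣-id _))))

module Partition where
  open import Data.Bool using (Bool; true; false; not; if_then_else_)
  open import Data.Bool.Properties using (not-¬; if-float)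
  open import Data.Fin using (Fin)
  open import Data.Fin.Subset using (Subset)
  open import Data.Nat using (ℕ; _+_; _*_; _^_; _≤_)
  open import Data.Product using (_,_)
  open import Data.Sum using (_⊎_; inj₁; inj₂; [_,_]′)
  open import Data.Vec using (lookup)
  open import Function using (_∘_)
  open import Relation.Binary.PropositionalEquality using (_≡_; _≢_; refl; sym; trans; cong; subst₂)
  open import Defs
  open SubcubeCounting using (subcube-count)
  open Sums using (Σℕ-cong)

  private variable
    N n m m′ : ℕ
    L : Cube N

  empty-subcube : Subcube N L 0
  empty-subcube = record
    { rows = λ () ; cols = λ () ; files = λ () ; syms = λ ()
    ; rows-inj = λ { {()} } ; cols-inj = λ { {()} } ; files-inj = λ { {()} } ; syms-inj = λ { {()} }
    ; sub = λ () ; sub-latin = (λ ()) , (λ ()) , (λ ()) ; sub-eq = λ ()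
    }

  restrict : (b : Bool) → Subcube N L m → Subcube N L (if b then m else 0)
  restrict true  S = S
  restrict false _ = empty-subcube

  restrict-disjoint : {S : Subcube N L m} {T : Subcube N L m′} (b c : Bool) →
                      (b ≡ true → c ≡ true → Disjoint S T) → Disjoint (restrict b S) (restrict c T)
  restrict-disjoint true  true  S#T = S#T refl refl
  restrict-disjoint true  false _   = (λ _ ()) , (λ _ ()) , (λ _ ()) , (λ _ ())
  restrict-disjoint false _     _   = (λ ()) , (λ ()) , (λ ()) , (λ ())

  -- Both halves are indexed by all of Fin n; a subcube on the wrong side of D becomes empty.
  module _ {h : Fin n → ℕ} (D : Subset n) where

    inside outside : Fin n → ℕ
    inside  i = if lookup D i then h i else 0
    outside i = if not (lookup D i) then h i else 0

    partition : ((i : Fin n) → Subcube N L (h i)) →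
                (k : Fin n ⊎ Fin n) → Subcube N L ([ inside , outside ]′ k)
    partition S (inj₁ i) = restrict (lookup D i) (S i)
    partition S (inj₂ i) = restrict (not (lookup D i)) (S i)

    partition-disjoint : {S : (i : Fin n) → Subcube N L (h i)} →
                         (∀ i j → i ≢ j → Disjoint (S i) (S j)) →
                         ∀ k l → k ≢ l → Disjoint (partition S k) (partition S l)
    partition-disjoint S# (inj₁ i) (inj₁ j) k≢l = restrict-disjoint _ _ λ _ _ → S# i j (k≢l ∘ cong inj₁)
    partition-disjoint S# (inj₂ i) (inj₂ j) k≢l = restrict-disjoint _ _ λ _ _ → S# i j (k≢l ∘ cong inj₂)
    partition-disjoint S# (inj₁ i) (inj₂ j) _   =
      restrict-disjoint _ _ λ p q → S# i j λ { refl → not-¬ refl (trans p (sym q)) }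
    partition-disjoint S# (inj₂ i) (inj₁ j) _   =
      restrict-disjoint _ _ λ q p → S# i j λ { refl → not-¬ refl (trans p (sym q)) }

  LC-count : {h : Fin n → ℕ} → LC h → (D : Subset n) →
             let N = Σℕ h in
             Σℕ (λ i → if not (lookup D i) then h i ^ 3 else 0)
               + (N ^ 2 * ΣIn D h + 3 * (ΣIn D (λ i → h i ^ 2) * Σℕ (outside D)))
             ≤ N ^ 3
  LC-count {h = h} (L , S , latin , S#) D =
    subst₂ (λ a d → a + (Σℕ h ^ 2 * ΣIn D h + 3 * (d * Σℕ (outside D))) ≤ Σℕ h ^ 3)
           (Σℕ-cong λ i → if-float (_^ 3) (not (lookup D i)))
           (Σℕ-cong λ i → if-float (_^ 2) (lookup D i))
           (subcube-count latin (partition D S) (partition-disjoint D S#))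

module IntegerArithmetic where
  open import Data.Nat as ℕ using (ℕ; _^_)
  open import Data.Integer using (+_; _+_; _-_; _*_; -_; _≤_; +≤+)
  open import Data.Integer.Properties using (pos-+; pos-*; +-monoˡ-≤; module ≤-Reasoning)
  open import Data.Integer.Tactic.RingSolver using (solve-∀)
  open import Relation.Binary.PropositionalEquality using (_≡_; refl; sym; trans; cong; cong₂)

  rearrange-bound : ∀ {N s r D2 D3 A3 T3 : ℕ} → N ≡ s ℕ.+ r → T3 ≡ D3 ℕ.+ A3 →
                     A3 ℕ.+ (N ^ 2 ℕ.* s ℕ.+ 3 ℕ.* (D2 ℕ.* r)) ℕ.≤ N ^ 3 →
                     + (N ^ 2 ℕ.* s) + + 3 * + D2 * (+ N - + s) - + D3 ≤ + (N ^ 3) - + T3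
  rearrange-bound {N} {s} {r} {D2} {D3} {A3} refl refl count = begin
    + P + + 3 * + D2 * (+ (s ℕ.+ r) - + s) - + D3
      ≡⟨ cong (λ m → + P + + 3 * + D2 * (m - + s) - + D3) (pos-+ s r) ⟩
    + P + + 3 * + D2 * (+ s + + r - + s) - + D3
      ≡⟨ regroup (+ P) (+ D2) (+ s) (+ r) (+ D3) (+ A3) ⟩
    (+ A3 + (+ P + + 3 * (+ D2 * + r))) - (+ D3 + + A3)
      ≡⟨ cong₂ _-_ (sym embed) (sym (pos-+ D3 A3)) ⟩
    + (A3 ℕ.+ (P ℕ.+ 3 ℕ.* (D2 ℕ.* r))) - + (D3 ℕ.+ A3)
      ≤⟨ +-monoˡ-≤ (- + (D3 ℕ.+ A3)) (+≤+ count) ⟩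
    + (N ^ 3) - + (D3 ℕ.+ A3) ∎
    where
    open ≤-Reasoning
    P = N ^ 2 ℕ.* s
    regroup : ∀ p d σ ν δ α → p + + 3 * d * (σ + ν - σ) - δ ≡ (α + (p + + 3 * (d * ν))) - (δ + α)
    regroup = solve-∀
    embed : + (A3 ℕ.+ (P ℕ.+ 3 ℕ.* (D2 ℕ.* r))) ≡ + A3 + (+ P + + 3 * (+ D2 * + r))
    embed = trans (pos-+ A3 _) (cong (_+_ (+ A3)) (trans (pos-+ P _)
              (cong (_+_ (+ P)) (trans (pos-* 3 (D2 ℕ.* r)) (cong (+ 3 *_) (pos-* D2 r))))))

open import Defs
open import Data.Nat using (ℕ; _≤_; _<_; _^_) renaming (_*_ to _*ℕ_)
open import Data.Integer using (ℤ; +_; _-_; _*_; _+_)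
open import Data.Integer using () renaming (_≤_ to _≤ℤ_)
open import Data.Fin using (Fin) renaming (_≤_ to _≤ᶠ_)
open import Data.Fin.Subset using (Subset)
open import Data.Vec using (lookup)
open Sums using (Σℕ-split)
open IntegerArithmetic using (rearrange-bound)
open Partition using (LC-count)

theorem10 : (n : ℕ) (h : Fin n → ℕ)
    → (∀ i j → i ≤ᶠ j → h j ≤ h i)
    → (∀ i → 0 < h i)
    → LC h
    → (D : Subset n)
    → let N = Σℕ h
          s = ΣIn D h
      in (+ (N ^ 2 *ℕ s)) + (+ 3) * (+ ΣIn D (λ i → h i ^ 2)) * (+ N - + s)
           - (+ ΣIn D (λ i → h i ^ 3))
         ≤ℤ (+ (N ^ 3)) - (+ Σℕ (λ i → h i ^ 3))
theorem10 n h _ _ lc D =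
  rearrange-bound {D2 = ΣIn D (λ i → h i ^ 2)}
    (Σℕ-split (lookup D) h) (Σℕ-split (lookup D) (λ i → h i ^ 3)) (LC-count lc D)
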